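{- Let $p$ and $q$ be integers with $q\geq 0$, and let $n\geq 1$ be an integer. Then \[ q!\,H_n^{(p,q+1)}=\sum_{k=0}^{q}(-1)^{k}\genfrac{[}{]}{0pt}{}{q}{k}_{n+1}H_n^{(p-k)}. \]
   Context: For $p\in\mathbb{Z}$ and $n\geq1$, $H_n^{(p)}=\sum_{j=1}^{n}j^{ -p}$ (generalized harmonic number; $H_0^{(p)}=0$). The generalized hyperharmonic numbers are defined by $H_n^{(p,0)}=1/n^{p}$ and $H_n^{(p,r)}=\sum_{k=1}^{n}H_k^{(p,r-1)}$ for $r\geq1$ (so $H_n^{(p,1)}=H_n^{(p)}$). The $r$-Stirling numbers of the first kind $\genfrac{[}{]}{0pt}{}{q}{j}_{r}$ are defined by $(x+r)(x+r+1)\cdots(x+r+q-1)=\sum_{j=0}^{q}\genfrac{[}{]}{0pt}{}{q}{j}_{r}x^{j}$. -}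

module Defs where

open import Data.Nat as ℕ using (ℕ; zero; suc)
open import Data.Nat.Properties using (m^n≢0)
open import Data.Integer as ℤ using (ℤ; +_; -[1+_])
open import Data.Rational as ℚ using (ℚ; 0ℚ; 1ℚ; _+_; _*_)
open import Data.List using (List; []; _∷_)

ofℕ : ℕ → ℚ
ofℕ m = (+ m) ℚ./ 1

-- (suc i)^(-p) as a rational, for p ∈ ℤ:
--   p = + m       : 1 / (i+1)^m
--   p = -[1+ m ]  : (i+1)^(m+1)       (p = -(m+1))
invPowSuc : ℕ → ℤ → ℚ
invPowSuc i (+ m) = (+ 1) ℚ./ (suc i ℕ.^ m)
  where instance _ = m^n≢0 (suc i) m
invPowSuc i -[1+ m ] = ofℕ (suc i ℕ.^ suc m)

sum1 : ℕ → (ℕ → ℚ) → ℚ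
sum1 zero    f = 0ℚ
sum1 (suc n) f = sum1 n f + f (suc n)

H : ℤ → ℕ → ℚ
H p n = sum1 n (λ { zero → 0ℚ ; (suc i) → invPowSuc i p })
-- (the zero branch is never used since sum1 only evaluates at j ≥ 1)

-- generalized hyperharmonic numbers H_n^{(p,r)}:
--   H_n^{(p,0)} = 1/n^p (n ≥ 1),  H_n^{(p,r)} = Σ_{k=1}^n H_k^{(p,r-1)}.
-- The value at n = 0, r = 0 is never used by the recursion (set to 0).
hyperH : ℤ → ℕ → ℕ → ℚ
hyperH p zero    zero    = 0ℚ
hyperH p zero    (suc i) = invPowSuc i p
hyperH p (suc r) n       = sum1 n (hyperH p r)

-- coefficient list (lowest degree first) of a polynomial in x over ℕ.
-- multiply a polynomial by (x + c)
mulXplus : ℕ → List ℕ → List ℕ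
mulXplus c []       = []
mulXplus c (a ∷ as) = c ℕ.* a ∷ go a as
  where
    go : ℕ → List ℕ → List ℕ
    go prev []       = prev ∷ []
    go prev (b ∷ bs) = prev ℕ.+ c ℕ.* b ∷ go b bs

risingPoly : ℕ → ℕ → List ℕ
risingPoly r zero    = 1 ∷ []
risingPoly r (suc q) = mulXplus (r ℕ.+ q) (risingPoly r q)

coeff : List ℕ → ℕ → ℕ
coeff []       _       = 0
coeff (a ∷ as) zero    = a
coeff (a ∷ as) (suc j) = coeff as j

rStirling : ℕ → ℕ → ℕ → ℕ
rStirling r q j = coeff (risingPoly r q) j

sum0 : ℕ → (ℕ → ℚ) → ℚ
sum0 zero    f = f 0
sum0 (suc q) f = sum0 q f + f (suc q)

sign : ℕ → ℚ
sign zero    = 1ℚ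
sign (suc k) = ℚ.- sign k

-- Both sides equal  Σ_{j=1}^n (n+1-j)(n+2-j)⋯(n+q-j) · j^{-p}.
-- Left: iterating partial sums q+1 times weights the j-th term by the rising
-- factorial (n+1-j)^{(q)} / q!; induction on n closes by the Pascal-type
-- recurrence (a+1)^{(q+1)} = a^{(q+1)} + (q+1)·(a+1)^{(q)}.
-- Right: H_n^{(p-k)} = Σ_j j^k · j^{-p}, so after swapping the sums the inner
-- sum Σ_k (-1)^k [q k]_{n+1} j^k is the polynomial (x+n+1)⋯(x+n+q) at x = -j.
module Submission where

open import Defs
open import Data.Nat using (ℕ; suc; _≥_; _!)
open import Data.Integer using (ℤ; _-_; +_)
open import Data.Rational using (ℚ; _*_)
open import Relation.Binary.PropositionalEquality using (_≡_)

open import Data.Nat as N using (zero; _≤_; _<_; _∸_; NonZero)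
import Data.Nat.Properties as NP
import Data.Nat.Solver as NS
open import Data.Integer as Z using (-[1+_])
import Data.Integer.Properties as ZP
import Data.Integer.Solver as ZS
open import Data.Rational as Q using (0ℚ; 1ℚ; _+_; -_)
import Data.Rational.Properties as QP
import Data.Rational.Solver as QS
open import Data.Rational.Unnormalised as U using (mkℚᵘ; *≡*)
import Data.Rational.Unnormalised.Properties as UP
open import Algebra.Definitions.RawSemiring Q.+-*-rawSemiring using (_^_)
open import Data.List using (List; []; _∷_; drop; length)
open import Relation.Binary.PropositionalEquality
  using (refl; sym; trans; cong; cong₂; module ≡-Reasoning)

fromℚᵘ-homo-+ : ∀ x y → Q.fromℚᵘ (x U.+ y) ≡ Q.fromℚᵘ x + Q.fromℚᵘ y
fromℚᵘ-homo-+ x y = QP.toℚᵘ-injective (UP.≃-trans (QP.toℚᵘ-fromℚᵘ (x U.+ y))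
  (UP.≃-trans (UP.+-cong (UP.≃-sym (QP.toℚᵘ-fromℚᵘ x)) (UP.≃-sym (QP.toℚᵘ-fromℚᵘ y)))
              (UP.≃-sym (QP.toℚᵘ-homo-+ (Q.fromℚᵘ x) (Q.fromℚᵘ y)))))

fromℚᵘ-homo-* : ∀ x y → Q.fromℚᵘ (x U.* y) ≡ Q.fromℚᵘ x * Q.fromℚᵘ y
fromℚᵘ-homo-* x y = QP.toℚᵘ-injective (UP.≃-trans (QP.toℚᵘ-fromℚᵘ (x U.* y))
  (UP.≃-trans (UP.*-cong (UP.≃-sym (QP.toℚᵘ-fromℚᵘ x)) (UP.≃-sym (QP.toℚᵘ-fromℚᵘ y)))
              (UP.≃-sym (QP.toℚᵘ-homo-* (Q.fromℚᵘ x) (Q.fromℚᵘ y)))))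

ofℕ-homo-+ : ∀ a b → ofℕ (a N.+ b) ≡ ofℕ a + ofℕ b
ofℕ-homo-+ a b = trans
  (QP.fromℚᵘ-cong {mkℚᵘ (+ (a N.+ b)) 0} {mkℚᵘ (+ a) 0 U.+ mkℚᵘ (+ b) 0}
    (*≡* (cong (Z._* + 1) (trans (ZP.pos-+ a b)
      (sym (cong₂ Z._+_ (ZP.*-identityʳ (+ a)) (ZP.*-identityʳ (+ b))))))))
  (fromℚᵘ-homo-+ (mkℚᵘ (+ a) 0) (mkℚᵘ (+ b) 0))

ofℕ-homo-* : ∀ a b → ofℕ (a N.* b) ≡ ofℕ a * ofℕ b
ofℕ-homo-* a b = trans
  (QP.fromℚᵘ-cong {mkℚᵘ (+ (a N.* b)) 0} {mkℚᵘ (+ a) 0 U.* mkℚᵘ (+ b) 0}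
    (*≡* (cong (Z._* + 1) (ZP.pos-* a b))))
  (fromℚᵘ-homo-* (mkℚᵘ (+ a) 0) (mkℚᵘ (+ b) 0))

1/d≡k*1/[k*d] : ∀ k d .{{_ : NonZero k}} .{{_ : NonZero d}} →
                (+ 1 Q./ d) ≡ ofℕ k * Q._/_ (+ 1) (k N.* d) {{NP.m*n≢0 k d}}
1/d≡k*1/[k*d] (suc k) (suc d) = trans
  (QP.fromℚᵘ-cong {mkℚᵘ (+ 1) d} {mkℚᵘ (+ suc k) 0 U.* mkℚᵘ (+ 1) (d N.+ k N.* suc d)}
    (*≡* (cong +_ (solve 2 (λ k d → con 1 :* (con 1 :* (con 1 :+ (d :+ k :* (con 1 :+ d))))
                                    := ((con 1 :+ k) :* con 1) :* (con 1 :+ d)) refl k d))))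
  (fromℚᵘ-homo-* (mkℚᵘ (+ suc k) 0) (mkℚᵘ (+ 1) (d N.+ k N.* suc d)))
  where open NS.+-*-Solver

invPowSuc-∸1 : ∀ i p → invPowSuc i (p - + 1) ≡ ofℕ (suc i) * invPowSuc i p
invPowSuc-∸1 i (+ zero)  = ofℕ-homo-* (suc i) 1
invPowSuc-∸1 i (+ suc m) = 1/d≡k*1/[k*d] (suc i) (suc i N.^ m) {{_}} {{NP.m^n≢0 (suc i) m}}
invPowSuc-∸1 i -[1+ m ] rewrite NP.+-identityʳ m = ofℕ-homo-* (suc i) (suc i N.^ suc m)

invPowSuc-∸ : ∀ i p k → invPowSuc i (p - + k) ≡ ofℕ (suc i) ^ k * invPowSuc i p
invPowSuc-∸ i p zero = trans (cong (invPowSuc i) (ZP.+-identityʳ p)) (sym (QP.*-identityˡ _))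
invPowSuc-∸ i p (suc k) = begin
  invPowSuc i (p - + suc k)                  ≡⟨ cong (invPowSuc i) p-[1+k]≡p-k-1 ⟩
  invPowSuc i ((p - + k) - + 1)              ≡⟨ invPowSuc-∸1 i (p - + k) ⟩
  x * invPowSuc i (p - + k)                  ≡⟨ cong (x *_) (invPowSuc-∸ i p k) ⟩
  x * (x ^ k * invPowSuc i p)                ≡⟨ QP.*-assoc x (x ^ k) (invPowSuc i p) ⟨
  x ^ suc k * invPowSuc i p                  ∎
  where
  open ≡-Reasoning
  x = ofℕ (suc i)
  p-[1+k]≡p-k-1 : p - + suc k ≡ (p - + k) - + 1
  p-[1+k]≡p-k-1 = trans (cong (λ t → p - t) (ZP.pos-+ 1 k))
    (solve 3 (λ p a b → p :- (a :+ b) := (p :- b) :- a) refl p (+ 1) (+ k))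
    where open ZS.+-*-Solver

[-x]^k≡sign[k]*x^k : ∀ x k → (- x) ^ k ≡ sign k * x ^ k
[-x]^k≡sign[k]*x^k x zero = sym (QP.*-identityˡ 1ℚ)
[-x]^k≡sign[k]*x^k x (suc k) = trans (cong (- x *_) ([-x]^k≡sign[k]*x^k x k))
  (solve 3 (λ x s P → (:- x) :* (s :* P) := (:- s) :* (x :* P)) refl x (sign k) (x ^ k))
  where open QS.+-*-Solver

sum1-cong : ∀ n {f g : ℕ → ℚ} → (∀ i → i < n → f (suc i) ≡ g (suc i)) → sum1 n f ≡ sum1 n g
sum1-cong zero    f≗g = refl
sum1-cong (suc n) f≗g =
  cong₂ _+_ (sum1-cong n (λ i i<n → f≗g i (NP.m<n⇒m<1+n i<n))) (f≗g n (NP.n<1+n n))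

sum1-+ : ∀ n (f g : ℕ → ℚ) → sum1 n (λ j → f j + g j) ≡ sum1 n f + sum1 n g
sum1-+ zero    f g = refl
sum1-+ (suc n) f g = trans (cong (_+ (f (suc n) + g (suc n))) (sum1-+ n f g))
  (solve 4 (λ a b c d → (a :+ b) :+ (c :+ d) := (a :+ c) :+ (b :+ d)) refl
     (sum1 n f) (sum1 n g) (f (suc n)) (g (suc n)))
  where open QS.+-*-Solver

sum1-*ˡ : ∀ n c (f : ℕ → ℚ) → sum1 n (λ j → c * f j) ≡ c * sum1 n f
sum1-*ˡ zero    c f = sym (QP.*-zeroʳ c)
sum1-*ˡ (suc n) c f = trans (cong (_+ c * f (suc n)) (sum1-*ˡ n c f))
  (sym (QP.*-distribˡ-+ c (sum1 n f) (f (suc n))))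

sum0-cong : ∀ q {f g : ℕ → ℚ} → (∀ k → f k ≡ g k) → sum0 q f ≡ sum0 q g
sum0-cong zero    f≗g = f≗g 0
sum0-cong (suc q) f≗g = cong₂ _+_ (sum0-cong q f≗g) (f≗g (suc q))

sum0-*ˡ : ∀ q c (f : ℕ → ℚ) → sum0 q (λ k → c * f k) ≡ c * sum0 q f
sum0-*ˡ zero    c f = refl
sum0-*ˡ (suc q) c f = trans (cong (_+ c * f (suc q)) (sum0-*ˡ q c f))
  (sym (QP.*-distribˡ-+ c (sum0 q f) (f (suc q))))

sum0-*ʳ : ∀ q c (f : ℕ → ℚ) → sum0 q (λ k → f k * c) ≡ sum0 q f * c
sum0-*ʳ zero    c f = refl
sum0-*ʳ (suc q) c f = trans (cong (_+ f (suc q) * c) (sum0-*ʳ q c f))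
  (sym (QP.*-distribʳ-+ c (sum0 q f) (f (suc q))))

sum0-suc : ∀ q (f : ℕ → ℚ) → sum0 (suc q) f ≡ f 0 + sum0 q (λ k → f (suc k))
sum0-suc zero    f = refl
sum0-suc (suc q) f = trans (cong (_+ f (suc (suc q))) (sum0-suc q f)) (QP.+-assoc (f 0) _ _)

sum0-sum1-comm : ∀ q n (F : ℕ → ℕ → ℚ) →
                 sum0 q (λ k → sum1 n (F k)) ≡ sum1 n (λ j → sum0 q (λ k → F k j))
sum0-sum1-comm zero    n F = refl
sum0-sum1-comm (suc q) n F = trans (cong (_+ sum1 n (F (suc q))) (sum0-sum1-comm q n F))
  (sym (sum1-+ n (λ j → sum0 q (λ k → F k j)) (F (suc q))))

eval : List ℕ → ℚ → ℚ
eval []       x = 0ℚ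
eval (a ∷ as) x = ofℕ a + x * eval as x

-- The helper `go` local to mulXplus, which cannot be referred to from outside.
mulXplus-go : ℕ → ℕ → List ℕ → List ℕ
mulXplus-go c prev []       = prev ∷ []
mulXplus-go c prev (b ∷ bs) = prev N.+ c N.* b ∷ mulXplus-go c b bs

mulXplus-∷ : ∀ c a as → mulXplus c (a ∷ as) ≡ c N.* a ∷ mulXplus-go c a as
mulXplus-∷ c a []       = refl
mulXplus-∷ c a (b ∷ bs) = cong (λ t → c N.* a ∷ a N.+ c N.* b ∷ drop 1 t) (mulXplus-∷ c b bs)

eval-mulXplus-go : ∀ c prev bs x →
                   eval (mulXplus-go c prev bs) x ≡ ofℕ prev + (x + ofℕ c) * eval bs x
eval-mulXplus-go c prev [] x =
  solve 3 (λ P x C → P :+ x :* con 0ℚ := P :+ (x :+ C) :* con 0ℚ) refl (ofℕ prev) x (ofℕ c)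
  where open QS.+-*-Solver
eval-mulXplus-go c prev (b ∷ bs) x = begin
  ofℕ (prev N.+ c N.* b) + x * eval (mulXplus-go c b bs) x
    ≡⟨ cong₂ (λ u v → u + x * v)
         (trans (ofℕ-homo-+ prev (c N.* b)) (cong (λ t → ofℕ prev + t) (ofℕ-homo-* c b)))
         (eval-mulXplus-go c b bs x) ⟩
  (ofℕ prev + ofℕ c * ofℕ b) + x * (ofℕ b + (x + ofℕ c) * eval bs x)
    ≡⟨ solve 5 (λ P C B x E → (P :+ C :* B) :+ x :* (B :+ (x :+ C) :* E)
                              := P :+ (x :+ C) :* (B :+ x :* E))
         refl (ofℕ prev) (ofℕ c) (ofℕ b) x (eval bs x) ⟩
  ofℕ prev + (x + ofℕ c) * (ofℕ b + x * eval bs x) ∎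
  where open ≡-Reasoning
        open QS.+-*-Solver

eval-mulXplus : ∀ c as x → eval (mulXplus c as) x ≡ (x + ofℕ c) * eval as x
eval-mulXplus c []       x = sym (QP.*-zeroʳ (x + ofℕ c))
eval-mulXplus c (a ∷ as) x = begin
  eval (mulXplus c (a ∷ as)) x                         ≡⟨ cong (λ L → eval L x) (mulXplus-∷ c a as) ⟩
  ofℕ (c N.* a) + x * eval (mulXplus-go c a as) x
    ≡⟨ cong₂ (λ u v → u + x * v) (ofℕ-homo-* c a) (eval-mulXplus-go c a as x) ⟩
  ofℕ c * ofℕ a + x * (ofℕ a + (x + ofℕ c) * eval as x)
    ≡⟨ solve 4 (λ C A x E → C :* A :+ x :* (A :+ (x :+ C) :* E) := (x :+ C) :* (A :+ x :* E))
         refl (ofℕ c) (ofℕ a) x (eval as x) ⟩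
  (x + ofℕ c) * eval (a ∷ as) x                        ∎
  where open ≡-Reasoning
        open QS.+-*-Solver

length-mulXplus-go : ∀ c prev bs → length (mulXplus-go c prev bs) ≡ suc (length bs)
length-mulXplus-go c prev []       = refl
length-mulXplus-go c prev (b ∷ bs) = cong suc (length-mulXplus-go c b bs)

length-risingPoly : ∀ r q → length (risingPoly r q) ≡ suc q
length-risingPoly r zero = refl
length-risingPoly r (suc q) with risingPoly r q | length-risingPoly r q
... | a ∷ as | ∣L∣≡1+q = trans (cong length (mulXplus-∷ (r N.+ q) a as))
                               (cong suc (trans (length-mulXplus-go (r N.+ q) a as) ∣L∣≡1+q))

sum0-coeff≡eval : ∀ q L x → length L ≡ suc q → sum0 q (λ k → ofℕ (coeff L k) * x ^ k) ≡ eval L x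
sum0-coeff≡eval zero (a ∷ []) x _ =
  solve 2 (λ a x → a :* con 1ℚ := a :+ x :* con 0ℚ) refl (ofℕ a) x
  where open QS.+-*-Solver
sum0-coeff≡eval (suc q) (a ∷ as) x ∣L∣≡2+q = begin
  sum0 (suc q) (λ k → ofℕ (coeff (a ∷ as) k) * x ^ k)
    ≡⟨ sum0-suc q (λ k → ofℕ (coeff (a ∷ as) k) * x ^ k) ⟩
  ofℕ a * 1ℚ + sum0 q (λ k → ofℕ (coeff as k) * (x * x ^ k))
    ≡⟨ cong₂ _+_ (QP.*-identityʳ (ofℕ a)) (sum0-cong q (λ k →
         solve 3 (λ c x P → c :* (x :* P) := x :* (c :* P)) refl (ofℕ (coeff as k)) x (x ^ k))) ⟩
  ofℕ a + sum0 q (λ k → x * (ofℕ (coeff as k) * x ^ k))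
    ≡⟨ cong (λ t → ofℕ a + t) (sum0-*ˡ q x (λ k → ofℕ (coeff as k) * x ^ k)) ⟩
  ofℕ a + x * sum0 q (λ k → ofℕ (coeff as k) * x ^ k)
    ≡⟨ cong (λ t → ofℕ a + x * t) (sum0-coeff≡eval q as x (NP.suc-injective ∣L∣≡2+q)) ⟩
  ofℕ a + x * eval as x ∎
  where open ≡-Reasoning
        open QS.+-*-Solver

rising : ℕ → ℕ → ℕ
rising a zero    = 1
rising a (suc q) = rising a q N.* (a N.+ q)

rising-suc : ∀ a q → rising a (suc q) ≡ a N.* rising (suc a) q
rising-suc a zero = solve 1 (λ a → con 1 :* (a :+ con 0) := a :* con 1) refl a
  where open NS.+-*-Solver
rising-suc a (suc q) = trans (cong (N._* (a N.+ suc q)) (rising-suc a q))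
  (solve 3 (λ a R q → (a :* R) :* (a :+ (con 1 :+ q)) := a :* (R :* ((con 1 :+ a) :+ q)))
     refl a (rising (suc a) q) q)
  where open NS.+-*-Solver

rising-pascal : ∀ a q → rising (suc a) (suc q) ≡ rising a (suc q) N.+ suc q N.* rising (suc a) q
rising-pascal a q = trans
  (solve 3 (λ a R q → R :* ((con 1 :+ a) :+ q) := a :* R :+ (con 1 :+ q) :* R) refl a (rising (suc a) q) q)
  (cong (N._+ suc q N.* rising (suc a) q) (sym (rising-suc a q)))
  where open NS.+-*-Solver

eval-risingPoly : ∀ r q j → j ≤ r → eval (risingPoly r q) (- ofℕ j) ≡ ofℕ (rising (r ∸ j) q)
eval-risingPoly r zero j j≤r =
  trans (cong (λ t → ofℕ 1 + t) (QP.*-zeroʳ (- ofℕ j))) (QP.+-identityʳ (ofℕ 1))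
eval-risingPoly r (suc q) j j≤r = begin
  eval (mulXplus (r N.+ q) (risingPoly r q)) (- ofℕ j)
    ≡⟨ eval-mulXplus (r N.+ q) (risingPoly r q) (- ofℕ j) ⟩
  (- ofℕ j + ofℕ (r N.+ q)) * eval (risingPoly r q) (- ofℕ j)
    ≡⟨ cong₂ _*_ -j+[r+q]≡r-j+q (eval-risingPoly r q j j≤r) ⟩
  ofℕ (r ∸ j N.+ q) * ofℕ (rising (r ∸ j) q)
    ≡⟨ QP.*-comm (ofℕ (r ∸ j N.+ q)) (ofℕ (rising (r ∸ j) q)) ⟩
  ofℕ (rising (r ∸ j) q) * ofℕ (r ∸ j N.+ q)
    ≡⟨ ofℕ-homo-* (rising (r ∸ j) q) (r ∸ j N.+ q) ⟨
  ofℕ (rising (r ∸ j) (suc q)) ∎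
  where
  open ≡-Reasoning
  r+q≡[r-j+q]+j : r N.+ q ≡ (r ∸ j N.+ q) N.+ j
  r+q≡[r-j+q]+j = trans (cong (N._+ q) (sym (NP.m∸n+n≡m j≤r)))
    (solve 3 (λ u j q → (u :+ j) :+ q := (u :+ q) :+ j) refl (r ∸ j) j q)
    where open NS.+-*-Solver
  -j+[r+q]≡r-j+q : - ofℕ j + ofℕ (r N.+ q) ≡ ofℕ (r ∸ j N.+ q)
  -j+[r+q]≡r-j+q = trans
    (cong (λ t → - ofℕ j + t) (trans (cong ofℕ r+q≡[r-j+q]+j) (ofℕ-homo-+ (r ∸ j N.+ q) j)))
    (solve 2 (λ J U → :- J :+ (U :+ J) := U) refl (ofℕ j) (ofℕ (r ∸ j N.+ q)))
    where open QS.+-*-Solver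

sum1-rising-partialSums : ∀ (f : ℕ → ℚ) q n →
  sum1 n (λ m → ofℕ (suc q) * sum1 m (λ j → ofℕ (rising (suc m ∸ j) q) * f j))
  ≡ sum1 n (λ j → ofℕ (rising (suc n ∸ j) (suc q)) * f j)
sum1-rising-partialSums f q zero    = refl
sum1-rising-partialSums f q (suc n) = begin
  sum1 n (λ m → c * sum1 m (w m q)) + c * sum1 (suc n) (w (suc n) q)
    ≡⟨ cong (_+ c * sum1 (suc n) (w (suc n) q)) (sum1-rising-partialSums f q n) ⟩
  sum1 n (w n (suc q)) + c * sum1 (suc n) (w (suc n) q)
    ≡⟨ cong₂ _+_ lastTermVanishes (sum1-*ˡ (suc n) c (w (suc n) q)) ⟨
  sum1 (suc n) (w n (suc q)) + sum1 (suc n) (λ j → c * w (suc n) q j)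
    ≡⟨ sum1-+ (suc n) (w n (suc q)) (λ j → c * w (suc n) q j) ⟨
  sum1 (suc n) (λ j → w n (suc q) j + c * w (suc n) q j)
    ≡⟨ sum1-cong (suc n) pascal ⟩
  sum1 (suc n) (w (suc n) (suc q)) ∎
  where
  open ≡-Reasoning
  c = ofℕ (suc q)
  w : ℕ → ℕ → ℕ → ℚ
  w m q j = ofℕ (rising (suc m ∸ j) q) * f j
  lastTermVanishes : sum1 (suc n) (w n (suc q)) ≡ sum1 n (w n (suc q))
  lastTermVanishes = begin
    sum1 n (w n (suc q)) + ofℕ (rising (n ∸ n) (suc q)) * f (suc n)
      ≡⟨ cong (λ a → sum1 n (w n (suc q)) + ofℕ a * f (suc n))
              (trans (cong (λ a → rising a (suc q)) (NP.n∸n≡0 n)) (rising-suc 0 q)) ⟩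
    sum1 n (w n (suc q)) + 0ℚ * f (suc n)
      ≡⟨ cong (λ t → sum1 n (w n (suc q)) + t) (QP.*-zeroˡ (f (suc n))) ⟩
    sum1 n (w n (suc q)) + 0ℚ
      ≡⟨ QP.+-identityʳ _ ⟩
    sum1 n (w n (suc q)) ∎
  pascal : ∀ i → i < suc n → w n (suc q) (suc i) + c * w (suc n) q (suc i) ≡ w (suc n) (suc q) (suc i)
  pascal i i<1+n rewrite NP.+-∸-assoc 1 (NP.≤-pred i<1+n) = begin
    ofℕ (rising a (suc q)) * F + c * (ofℕ (rising (suc a) q) * F)
      ≡⟨ solve 4 (λ A c B F → A :* F :+ c :* (B :* F) := (A :+ c :* B) :* F) refl
           (ofℕ (rising a (suc q))) c (ofℕ (rising (suc a) q)) F ⟩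
    (ofℕ (rising a (suc q)) + c * ofℕ (rising (suc a) q)) * F
      ≡⟨ cong (_* F) (trans (ofℕ-homo-+ (rising a (suc q)) (suc q N.* rising (suc a) q))
                            (cong (λ t → ofℕ (rising a (suc q)) + t) (ofℕ-homo-* (suc q) (rising (suc a) q)))) ⟨
    ofℕ (rising a (suc q) N.+ suc q N.* rising (suc a) q) * F
      ≡⟨ cong (λ t → ofℕ t * F) (rising-pascal a q) ⟨
    ofℕ (rising (suc a) (suc q)) * F ∎
    where
    open QS.+-*-Solver
    a = n ∸ i
    F = f (suc i)

q!*hyperH≡risingSum : ∀ p q n →
  ofℕ (q !) * hyperH p (suc q) n ≡ sum1 n (λ j → ofℕ (rising (suc n ∸ j) q) * hyperH p 0 j)
q!*hyperH≡risingSum p zero    n = sym (sum1-*ˡ n 1ℚ (hyperH p 0))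
q!*hyperH≡risingSum p (suc q) n = begin
  ofℕ (suc q N.* q !) * sum1 n (hyperH p (suc q))
    ≡⟨ cong (_* sum1 n (hyperH p (suc q))) (ofℕ-homo-* (suc q) (q !)) ⟩
  (c * ofℕ (q !)) * sum1 n (hyperH p (suc q))
    ≡⟨ QP.*-assoc c (ofℕ (q !)) (sum1 n (hyperH p (suc q))) ⟩
  c * (ofℕ (q !) * sum1 n (hyperH p (suc q)))
    ≡⟨ cong (c *_) (sum1-*ˡ n (ofℕ (q !)) (hyperH p (suc q))) ⟨
  c * sum1 n (λ m → ofℕ (q !) * hyperH p (suc q) m)
    ≡⟨ cong (c *_) (sum1-cong n (λ i _ → q!*hyperH≡risingSum p q (suc i))) ⟩
  c * sum1 n (λ m → sum1 m (λ j → ofℕ (rising (suc m ∸ j) q) * hyperH p 0 j))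
    ≡⟨ sum1-*ˡ n c (λ m → sum1 m (λ j → ofℕ (rising (suc m ∸ j) q) * hyperH p 0 j)) ⟨
  sum1 n (λ m → c * sum1 m (λ j → ofℕ (rising (suc m ∸ j) q) * hyperH p 0 j))
    ≡⟨ sum1-rising-partialSums (hyperH p 0) q n ⟩
  sum1 n (λ j → ofℕ (rising (suc n ∸ j) (suc q)) * hyperH p 0 j) ∎
  where
  open ≡-Reasoning
  c = ofℕ (suc q)

H[p-k]≡sum1-j^k*hyperH : ∀ p k n → H (p - + k) n ≡ sum1 n (λ j → ofℕ j ^ k * hyperH p 0 j)
H[p-k]≡sum1-j^k*hyperH p k n = sum1-cong n (λ i _ → invPowSuc-∸ i p k)

stirlingSum≡risingSum : ∀ p q n →
  sum0 q (λ k → sign k * ofℕ (rStirling (suc n) q k) * H (p - + k) n)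
  ≡ sum1 n (λ j → ofℕ (rising (suc n ∸ j) q) * hyperH p 0 j)
stirlingSum≡risingSum p q n = begin
  sum0 q (λ k → sign k * ofℕ (S k) * H (p - + k) n)
    ≡⟨ sum0-cong q (λ k → trans (cong (sign k * ofℕ (S k) *_) (H[p-k]≡sum1-j^k*hyperH p k n))
                                (sym (sum1-*ˡ n (sign k * ofℕ (S k)) (λ j → ofℕ j ^ k * f j)))) ⟩
  sum0 q (λ k → sum1 n (λ j → sign k * ofℕ (S k) * (ofℕ j ^ k * f j)))
    ≡⟨ sum0-sum1-comm q n (λ k j → sign k * ofℕ (S k) * (ofℕ j ^ k * f j)) ⟩
  sum1 n (λ j → sum0 q (λ k → sign k * ofℕ (S k) * (ofℕ j ^ k * f j)))
    ≡⟨ sum1-cong n inner ⟩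
  sum1 n (λ j → ofℕ (rising (suc n ∸ j) q) * f j) ∎
  where
  open ≡-Reasoning
  S = rStirling (suc n) q
  f = hyperH p 0
  inner : ∀ i → i < n → sum0 q (λ k → sign k * ofℕ (S k) * (ofℕ (suc i) ^ k * f (suc i)))
                        ≡ ofℕ (rising (suc n ∸ suc i) q) * f (suc i)
  inner i i<n = begin
    sum0 q (λ k → sign k * ofℕ (S k) * (j ^ k * F))
      ≡⟨ sum0-cong q (λ k → trans
           (solve 4 (λ σ s P F → (σ :* s) :* (P :* F) := (s :* (σ :* P)) :* F)
              refl (sign k) (ofℕ (S k)) (j ^ k) F)
           (cong (λ t → ofℕ (S k) * t * F) (sym ([-x]^k≡sign[k]*x^k j k)))) ⟩
    sum0 q (λ k → ofℕ (S k) * (- j) ^ k * F)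
      ≡⟨ sum0-*ʳ q F (λ k → ofℕ (S k) * (- j) ^ k) ⟩
    sum0 q (λ k → ofℕ (S k) * (- j) ^ k) * F
      ≡⟨ cong (_* F) (sum0-coeff≡eval q (risingPoly (suc n) q) (- j) (length-risingPoly (suc n) q)) ⟩
    eval (risingPoly (suc n) q) (- j) * F
      ≡⟨ cong (_* F) (eval-risingPoly (suc n) q (suc i) (NP.m≤n⇒m≤1+n i<n)) ⟩
    ofℕ (rising (suc n ∸ suc i) q) * F ∎
    where
    open QS.+-*-Solver
    j = ofℕ (suc i)
    F = f (suc i)

theorem1 : (p : ℤ) (q n : ℕ) → n ≥ 1 →
    ofℕ (q !) * hyperH p (suc q) n
      ≡ sum0 q (λ k → sign k * ofℕ (rStirling (suc n) q k) * H (p - + k) n)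
theorem1 p q n _ = trans (q!*hyperH≡risingSum p q n) (sym (stirlingSum≡risingSum p q n))
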